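{- Let $G$ be a finite simple graph and $r\ge 2$ an integer. The following are equivalent: (1) Either $|E(\mathrm{Con}_r(G))|\le 1$, or there exist a positive integer $k$ and an ordering of vertices $x_1,x_2,\ldots,x_k$ of $G$ such that (a) for each $i\in \{0,1,\ldots,k-1\}$, $E(\mathrm{Con}_r(G_i\setminus N_{G_i}[x_{i+1}])) = \emptyset$, where $G_0=G$ and $G_i=G\setminus\{x_1,\ldots,x_i\}$ for $i\ge 1$; and (b) $k$ is the least positive integer such that $|E(\mathrm{Con}_r(G\setminus\{x_1,\ldots,x_k\}))|\le 1$. (2) The simplicial complex $\Sigma_r(G)$ is vertex decomposable.
   Context: $\mathrm{Con}_r(H)$ is the clutter on $V(H)$ whose circuits are the $r$-subsets $W\subseteq V(H)$ with $H[W]$ connected. $\Sigma_r(G)$ is the simplicial complex generated by the sets $V(G)\setminus W$ for $W\in E(\mathrm{Con}_r(G))$ (it is the Alexander dual of the $r$-independence complex of $G$; it is the void complex if there are no such $W$). $G\setminus S$ denotes the induced subgraph on $V(G)\setminus S$; $N_H[x]$ is the closed neighborhood. A simplicial complex $\Delta$ is vertex decomposable if it is a simplex, the empty complex $\{\emptyset\}$, the void complex, or has a vertex $x$ with $\mathrm{lk}_\Delta(x)$ and $\mathrm{del}_\Delta(x)$ vertex decomposable and every facet of $\mathrm{del}_\Delta(x)$ a facet of $\Delta$. -}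

module Defs where

open import Level using (Level; suc; zero)
open import Data.Nat using (ℕ; _≤_; _<_)
open import Data.Bool using (Bool; true; false)
open import Data.Fin using (Fin; toℕ)
open import Data.Fin.Subset using (Subset; _∈_; _∉_; _⊆_; _∪_; ⁅_⁆; ∣_∣)
open import Data.Product using (Σ; ∃; _×_)
open import Data.Sum using (_⊎_)
open import Relation.Binary.PropositionalEquality using (_≡_; _≢_)
open import Relation.Nullary using (¬_)

record Graph (n : ℕ) : Set where
  field
    adj    : Fin n → Fin n → Bool
    sym    : ∀ x y → adj x y ≡ adj y x
    irrefl : ∀ x → adj x x ≡ false
open Graph public

-- Vertex sets of induced subgraphs are given as predicates on Fin n.
VSet : ℕ → Set₁
VSet n = Fin n → Set

data WalkIn {n : ℕ} (G : Graph n) (W : Subset n) : Fin n → Fin n → Set where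
  here : ∀ {x} → x ∈ W → WalkIn G W x x
  step : ∀ {x y z} → x ∈ W → adj G x y ≡ true → WalkIn G W y z → WalkIn G W x z

Connected : {n : ℕ} → Graph n → Subset n → Set
Connected G W = ∀ x y → x ∈ W → y ∈ W → WalkIn G W x y

-- W is a circuit of Con_r(G[U]): an r-subset of U inducing a connected graph.
IsCircuit : {n : ℕ} → Graph n → ℕ → VSet n → Subset n → Set
IsCircuit G r U W = (∀ y → y ∈ W → U y) × (∣ W ∣ ≡ r) × Connected G W

AtMostOneCircuit : {n : ℕ} → Graph n → ℕ → VSet n → Set
AtMostOneCircuit G r U = ∀ W W' → IsCircuit G r U W → IsCircuit G r U W' → W ≡ W'

NoCircuit : {n : ℕ} → Graph n → ℕ → VSet n → Set
NoCircuit G r U = ∀ W → ¬ IsCircuit G r U W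

AllV : {n : ℕ} → VSet n
AllV _ = Data.Unit.⊤
  where import Data.Unit

-- Vertex set of G_i = G \ {x_1,...,x_i}, for an ordering xs (xs j = x_{j+1}).
Remaining : {n k : ℕ} → (Fin k → Fin n) → ℕ → VSet n
Remaining xs i y = ∀ j → toℕ j < i → xs j ≢ y

-- Vertex set of G_i \ N_{G_i}[x_{i+1}]  (x_{i+1} = xs i).
RemainingMinusNbhd : {n k : ℕ} → Graph n → (Fin k → Fin n) → Fin k → VSet n
RemainingMinusNbhd G xs i y =
  Remaining xs (toℕ i) y × (xs i ≢ y) × (adj G (xs i) y ≡ false)

Injective : {n k : ℕ} → (Fin k → Fin n) → Set
Injective xs = ∀ i j → xs i ≡ xs j → i ≡ j

Condition1 : {n : ℕ} → Graph n → ℕ → Set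
Condition1 {n} G r =
  AtMostOneCircuit G r AllV
  ⊎ Σ ℕ λ k → Σ (Fin k → Fin n) λ xs →
      (1 ≤ k) × Injective xs
      × (∀ (i : Fin k) → NoCircuit G r (RemainingMinusNbhd G xs i))
      × AtMostOneCircuit G r (Remaining xs k)
      × (∀ j → 1 ≤ j → j < k → ¬ AtMostOneCircuit G r (Remaining xs j))

Complex : ℕ → Set₁
Complex n = Subset n → Set

-- Σ_r(G): generated by V(G) \ W for circuits W of Con_r(G).
-- A set is a face iff it is disjoint from some circuit W.
SigmaR : {n : ℕ} → Graph n → ℕ → Complex n
SigmaR G r σ = ∃ λ W → IsCircuit G r AllV W × (∀ x → x ∈ σ → x ∉ W)

IsFacet : {n : ℕ} → Complex n → Subset n → Set
IsFacet Δ F = Δ F × (∀ τ → Δ τ → F ⊆ τ → τ ⊆ F)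

-- Δ is a simplex: its faces are exactly the subsets of a single set F
-- (F = ∅ gives the empty complex {∅}).
IsSimplex : {n : ℕ} → Complex n → Set
IsSimplex Δ = ∃ λ F → ∀ σ → (Δ σ → σ ⊆ F) × (σ ⊆ F → Δ σ)

IsVoid : {n : ℕ} → Complex n → Set
IsVoid Δ = ∀ σ → ¬ Δ σ

link : {n : ℕ} → Complex n → Fin n → Complex n
link Δ x σ = x ∉ σ × Δ (σ ∪ ⁅ x ⁆)

deletion : {n : ℕ} → Complex n → Fin n → Complex n
deletion Δ x σ = x ∉ σ × Δ σ

data VertexDecomposable {n : ℕ} (Δ : Complex n) : Set₁ where
  simplex : IsSimplex Δ → VertexDecomposable Δ
  void    : IsVoid Δ → VertexDecomposable Δ
  shed    : (x : Fin n) → Δ ⁅ x ⁆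
          → VertexDecomposable (link Δ x)
          → VertexDecomposable (deletion Δ x)
          → (∀ F → IsFacet (deletion Δ x) F → IsFacet Δ F)
          → VertexDecomposable Δ

{-# OPTIONS --safe #-}
-- Write Σᵣ U S for the complex on U generated by the sets U ∖ W, where W ranges over the
-- r-circuits of G[U] containing S; thus Σ_r(G) is Σᵣ V(G) ∅. The link of x ∈ U is
-- Σᵣ (U - x) S. If S ∪ {x} is connected and x has a neighbour in every circuit W ⊇ S that
-- avoids it, then W can be traded for (W ∪ {x}) - z with z a non-cut vertex of G[W ∪ {x}]
-- outside S ∪ {x}; so the deletion of x is Σᵣ U (S ∪ {x}) and x is a shedding vertex.
--
-- (1) ⇒ (2): by (a), x_{i+1} has a neighbour in every circuit of G_i avoiding it, so it
-- sheds Σ_r(G_i) into the link Σ_r(G_{i+1}) and the deletion Σᵣ V(G_i) {x_{i+1}}. Growing a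
-- connected S one neighbour at a time makes every Σᵣ U S vertex decomposable: the growth
-- ends when S is a circuit (a simplex) or cannot grow (the void complex). Finally Σ_r(G_k)
-- is a simplex or void because G_k has at most one circuit.
--
-- (2) ⇒ (1): if x sheds Σᵣ U ∅ and W is a circuit of G[U] ∖ N[x], then U ∖ W ∖ {x} is a
-- facet of the deletion: a circuit missing it lies in W ∪ {x}, and cannot contain x since
-- r ≥ 2 and x has no neighbour in W. It is not a facet of Σᵣ U ∅, as U ∖ W is a face. So
-- shedding vertices satisfy (a), and following the links of a decomposition yields the
-- ordering, stopped at the first G_k with at most one circuit.
module Submission where

open import Defs hiding (sym)

open import Data.Nat using (ℕ; zero; suc; _+_; _≤_; _<_; s≤s; z≤n)
open import Data.Nat.Properties
  using (<-irrefl; ≤-<-trans; <⇒≱; ≤-trans; ≤-reflexive; ≤-pred; m≤m+n; +-suc; suc-injective)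
open import Data.Fin using (Fin; zero; suc)
open import Data.Fin.Properties using (any?; all?; _≟_)
open import Data.Fin.Subset
  using (Subset; inside; outside; _∈_; _∉_; _⊆_; _∪_; ⊤; _─_; _-_; ⁅_⁆; ∣_∣)
  renaming (⊥ to ∅)
open import Data.Fin.Subset.Properties
  using ( _∈?_; _⊆?_; anySubset?; nonempty?; drop-there; ∉⊥; ∈⊤; ⊆⊤; ⊆-min; ⊆-antisym
        ; p⊆p∪q; q⊆p∪q; ∪-identityˡ; x∈p∪q⁻; x∈p∪q⁺; x∈⁅x⁆; x∈⁅y⁆⇒x≡y; ∣⁅x⁆∣≡1
        ; p─⊥≡p; x∈p∧x∉q⇒x∈p─q; x∈p∧x≢y⇒x∈p-y; ∣p∣≤n; p⊆q⇒∣p∣≤∣q∣; p⊂q⇒∣p∣<∣q∣ )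
open import Data.Bool using (true; false)
import Data.Bool.Properties as Bool
import Data.Nat.Properties as ℕ using (_≟_)
open import Data.Vec using (_∷_; here; there)
import Data.Vec.Functional as Vector
open import Data.Vec.Properties using (≡-dec)
open import Data.Product using (∃; ∃₂; _×_; _,_; proj₁; proj₂; map₂)
open import Data.Sum using (_⊎_; inj₁; inj₂; [_,_]′)
open import Data.Empty using (⊥-elim)
open import Data.Unit using (tt)
open import Function using (_∘_; id)
open import Relation.Unary using (_≐_; _∩_) renaming (_⊆_ to _⊆ᵛ_)
open import Relation.Unary.Properties using (≐-sym; ≐-trans)
open import Relation.Nullary using (¬_; Dec; yes; no)
open import Relation.Nullary.Decidable using (_×-dec_; _→-dec_; ¬?; decidable-stable)
open import Relation.Binary.PropositionalEquality
  using (_≡_; _≢_; refl; cong; sym; trans; subst; module ≡-Reasoning)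

private
  variable
    n : ℕ
    Δ Δ′ : Complex n

x∈p─q⁻ : ∀ {x : Fin n} (p q : Subset n) → x ∈ p ─ q → x ∈ p × x ∉ q
x∈p─q⁻ (inside ∷ p) (outside ∷ q) here = here , λ ()
x∈p─q⁻ {x = zero} (inside ∷ p) (inside ∷ q) ()
x∈p─q⁻ {x = zero} (outside ∷ p) (inside ∷ q) ()
x∈p─q⁻ {x = zero} (outside ∷ p) (outside ∷ q) ()
x∈p─q⁻ (s ∷ p) (t ∷ q) (there x∈p─q) =
  let x∈p , x∉q = x∈p─q⁻ p q x∈p─q in there x∈p , x∉q ∘ drop-there

x∈p-y⁻ : ∀ {x y : Fin n} {p : Subset n} → x ∈ p - y → x ∈ p × x ≢ y
x∈p-y⁻ {y = y} {p} x∈p-y =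
  let x∈p , x∉⁅y⁆ = x∈p─q⁻ p ⁅ y ⁆ x∈p-y in x∈p , λ { refl → x∉⁅y⁆ (x∈⁅x⁆ y) }

x∈p∪⁅y⁆⁻ : ∀ {x y : Fin n} {p : Subset n} → x ∈ p ∪ ⁅ y ⁆ → x ∈ p ⊎ x ≡ y
x∈p∪⁅y⁆⁻ {y = y} {p} x∈p∪⁅y⁆ with x∈p∪q⁻ p ⁅ y ⁆ x∈p∪⁅y⁆
... | inj₁ x∈p = inj₁ x∈p
... | inj₂ x∈⁅y⁆ = inj₂ (x∈⁅y⁆⇒x≡y y x∈⁅y⁆)

⊈⇒∃∉ : ∀ {p q : Subset n} → ¬ p ⊆ q → ∃ λ x → x ∈ p × x ∉ q
⊈⇒∃∉ {p = p} {q} p⊈q with any? (λ x → x ∈? p ×-dec ¬? (x ∈? q))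
... | yes witness = witness
... | no none = ⊥-elim (p⊈q λ {x} x∈p → decidable-stable (x ∈? q) (λ x∉q → none (x , x∈p , x∉q)))

⊆∧∣q∣≤∣p∣⇒p≡q : ∀ {p q : Subset n} → p ⊆ q → ∣ q ∣ ≤ ∣ p ∣ → p ≡ q
⊆∧∣q∣≤∣p∣⇒p≡q {p = p} {q} p⊆q ∣q∣≤∣p∣ = ⊆-antisym p⊆q q⊆p
  where
  q⊆p : q ⊆ p
  q⊆p {x} x∈q with x ∈? p
  ... | yes x∈p = x∈p
  ... | no x∉p = ⊥-elim (<-irrefl refl (≤-<-trans ∣q∣≤∣p∣ (p⊂q⇒∣p∣<∣q∣ (p⊆q , x , x∈q , x∉p))))

x∈p⇒∣p∣≡1+∣p-x∣ : ∀ {x : Fin n} {p : Subset n} → x ∈ p → ∣ p ∣ ≡ suc ∣ p - x ∣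
x∈p⇒∣p∣≡1+∣p-x∣ {p = inside ∷ p} here = cong (suc ∘ ∣_∣) (sym (p─⊥≡p p))
x∈p⇒∣p∣≡1+∣p-x∣ {p = inside ∷ p} (there x∈p) = cong suc (x∈p⇒∣p∣≡1+∣p-x∣ x∈p)
x∈p⇒∣p∣≡1+∣p-x∣ {p = outside ∷ p} (there x∈p) = x∈p⇒∣p∣≡1+∣p-x∣ x∈p

p⊆q∪⁅x⁆⇒p-x≡q : ∀ {x : Fin n} {p q : Subset n} → q ⊆ p → x ∉ q → p ⊆ q ∪ ⁅ x ⁆ → p - x ≡ q
p⊆q∪⁅x⁆⇒p-x≡q {x = x} {p} {q} q⊆p x∉q p⊆q∪⁅x⁆ = ⊆-antisym ⊆q ⊇q
  where
  ⊆q : p - x ⊆ q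
  ⊆q y∈p-x with x∈p-y⁻ y∈p-x
  ... | y∈p , y≢x with x∈p∪⁅y⁆⁻ (p⊆q∪⁅x⁆ y∈p)
  ...   | inj₁ y∈q = y∈q
  ...   | inj₂ y≡x = ⊥-elim (y≢x y≡x)
  ⊇q : q ⊆ p - x
  ⊇q y∈q = x∈p∧x≢y⇒x∈p-y (q⊆p y∈q) λ { refl → x∉q y∈q }

x∉p⇒∣p∪⁅x⁆∣≡1+∣p∣ : ∀ {x : Fin n} {p : Subset n} → x ∉ p → ∣ p ∪ ⁅ x ⁆ ∣ ≡ suc ∣ p ∣
x∉p⇒∣p∪⁅x⁆∣≡1+∣p∣ {x = x} {p} x∉p = begin
  ∣ p ∪ ⁅ x ⁆ ∣          ≡⟨ x∈p⇒∣p∣≡1+∣p-x∣ {p = p ∪ ⁅ x ⁆} (x∈p∪q⁺ (inj₂ (x∈⁅x⁆ x))) ⟩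
  suc ∣ p ∪ ⁅ x ⁆ - x ∣  ≡⟨ cong (suc ∘ ∣_∣) (p⊆q∪⁅x⁆⇒p-x≡q (x∈p∪q⁺ ∘ inj₁) x∉p id) ⟩
  suc ∣ p ∣              ∎
  where open ≡-Reasoning

∣q∣≤1+f+∣p∣⇒∣q∣≤f+∣p∪⁅x⁆∣ : ∀ {f} {x : Fin n} {p q : Subset n} →
                             x ∉ p → ∣ q ∣ ≤ suc f + ∣ p ∣ → ∣ q ∣ ≤ f + ∣ p ∪ ⁅ x ⁆ ∣
∣q∣≤1+f+∣p∣⇒∣q∣≤f+∣p∪⁅x⁆∣ {f = f} {p = p} x∉p bound
  rewrite x∉p⇒∣p∪⁅x⁆∣≡1+∣p∣ x∉p | +-suc f ∣ p ∣ = bound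

x∈p⇒⁅x⁆⊆p : ∀ {x : Fin n} {p : Subset n} → x ∈ p → ⁅ x ⁆ ⊆ p
x∈p⇒⁅x⁆⊆p {x = x} x∈p y∈⁅x⁆ rewrite x∈⁅y⁆⇒x≡y x y∈⁅x⁆ = x∈p

p⊆q∧x∈q⇒p∪⁅x⁆⊆q : ∀ {x : Fin n} {p q : Subset n} → p ⊆ q → x ∈ q → p ∪ ⁅ x ⁆ ⊆ q
p⊆q∧x∈q⇒p∪⁅x⁆⊆q p⊆q x∈q y∈p∪⁅x⁆ with x∈p∪⁅y⁆⁻ y∈p∪⁅x⁆
... | inj₁ y∈p = p⊆q y∈p
... | inj₂ refl = x∈q

remaining-suc : ∀ {k t y} {xs : Fin (suc k) → Fin n} →
                xs zero ≢ y → Remaining (xs ∘ suc) t y → Remaining xs (suc t) y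
remaining-suc x≢y R zero _ = x≢y
remaining-suc x≢y R (suc j) (s≤s j<t) = R j j<t

remaining-suc⁻ : ∀ {k t y} {xs : Fin (suc k) → Fin n} →
                 Remaining xs (suc t) y → xs zero ≢ y × Remaining (xs ∘ suc) t y
remaining-suc⁻ R = R zero (s≤s z≤n) , λ j → R (suc j) ∘ s≤s

module Connectivity {n : ℕ} (G : Graph n) where

  private
    variable
      W M T : Subset n
      x y z t : Fin n

  walk-source : WalkIn G W x y → x ∈ W
  walk-source (here x∈W) = x∈W
  walk-source (step x∈W _ _) = x∈W

  walk-++ : WalkIn G W x y → WalkIn G W y z → WalkIn G W x z
  walk-++ (here _) q = q
  walk-++ (step x∈W e p) q = step x∈W e (walk-++ p q)

  walk-reverse : WalkIn G W x y → WalkIn G W y x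
  walk-reverse (here x∈W) = here x∈W
  walk-reverse (step x∈W e p) =
    walk-++ (walk-reverse p) (step (walk-source p) (trans (sym (Graph.sym G _ _)) e) (here x∈W))

  walk-mono : W ⊆ M → WalkIn G W x y → WalkIn G M x y
  walk-mono W⊆M (here x∈W) = here (W⊆M x∈W)
  walk-mono W⊆M (step x∈W e p) = step (W⊆M x∈W) e (walk-mono W⊆M p)

  Connected-⁅⁆ : Connected G ⁅ x ⁆
  Connected-⁅⁆ {x} u v u∈ v∈
    rewrite x∈⁅y⁆⇒x≡y x u∈ | x∈⁅y⁆⇒x≡y x v∈ = here (x∈⁅x⁆ x)

  Connected-∪⁅⁆ : Connected G W → x ∈ W → adj G x y ≡ true → Connected G (W ∪ ⁅ y ⁆)
  Connected-∪⁅⁆ {W} {x} {y} cW x∈W e = connected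
    where
    widen : ∀ {u v} → WalkIn G W u v → WalkIn G (W ∪ ⁅ y ⁆) u v
    widen = walk-mono (x∈p∪q⁺ ∘ inj₁)
    x→y : WalkIn G (W ∪ ⁅ y ⁆) x y
    x→y = step (x∈p∪q⁺ (inj₁ x∈W)) e (here (x∈p∪q⁺ (inj₂ (x∈⁅x⁆ y))))
    connected : Connected G (W ∪ ⁅ y ⁆)
    connected u v u∈ v∈ with x∈p∪⁅y⁆⁻ u∈ | x∈p∪⁅y⁆⁻ v∈
    ... | inj₁ u∈W | inj₁ v∈W = widen (cW u v u∈W v∈W)
    ... | inj₁ u∈W | inj₂ refl = walk-++ (widen (cW u x u∈W x∈W)) x→y
    ... | inj₂ refl | inj₁ v∈W = walk-++ (walk-reverse x→y) (widen (cW x v x∈W v∈W))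
    ... | inj₂ refl | inj₂ refl = here v∈

  CrossingEdge : Subset n → Subset n → Set
  CrossingEdge T M = ∃₂ λ a y → a ∈ T × y ∈ M × y ∉ T × adj G a y ≡ true

  crossingEdge? : ∀ T M → Dec (CrossingEdge T M)
  crossingEdge? T M =
    any? λ a → any? λ y → a ∈? T ×-dec y ∈? M ×-dec ¬? (y ∈? T) ×-dec adj G a y Bool.≟ true

  walk⇒crossingEdge : WalkIn G M x y → x ∈ T → y ∉ T → CrossingEdge T M
  walk⇒crossingEdge (here _) x∈T x∉T = ⊥-elim (x∉T x∈T)
  walk⇒crossingEdge {T = T} (step {x} {y} _ e p) x∈T end∉T with y ∈? T
  ... | yes y∈T = walk⇒crossingEdge p y∈T end∉T
  ... | no y∉T = x , y , x∈T , walk-source p , y∉T , e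

  noCrossingEdge⇒⊆ : Connected G M → t ∈ T → t ∈ M → ¬ CrossingEdge T M → M ⊆ T
  noCrossingEdge⇒⊆ {t = t} {T = T} cM t∈T t∈M noCrossing {x} x∈M with x ∈? T
  ... | yes x∈T = x∈T
  ... | no x∉T = ⊥-elim (noCrossing (walk⇒crossingEdge (cM t x t∈M x∈M) t∈T x∉T))

  connected? : ∀ M → Dec (Connected G M)
  connected? M with nonempty? M
  ... | no M-empty = yes λ x _ x∈M _ → ⊥-elim (M-empty (x , x∈M))
  ... | yes (t , t∈M) =
    grow (x∈⁅x⁆ t) (x∈p⇒⁅x⁆⊆p t∈M) Connected-⁅⁆ n (≤-trans (∣p∣≤n M) (m≤m+n n _))
    where
    grow : t ∈ T → T ⊆ M → Connected G T → ∀ f → ∣ M ∣ ≤ f + ∣ T ∣ → Dec (Connected G M)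
    grow {T} t∈T T⊆M cT f bound with crossingEdge? T M | f
    ... | yes (_ , y , _ , y∈M , y∉T , _) | zero =
      ⊥-elim (<⇒≱ (p⊂q⇒∣p∣<∣q∣ (T⊆M , y , y∈M , y∉T)) bound)
    ... | yes (a , y , a∈T , y∈M , y∉T , e) | suc f =
      grow (x∈p∪q⁺ (inj₁ t∈T)) (p⊆q∧x∈q⇒p∪⁅x⁆⊆q T⊆M y∈M) (Connected-∪⁅⁆ cT a∈T e) f
           (∣q∣≤1+f+∣p∣⇒∣q∣≤f+∣p∪⁅x⁆∣ {q = M} y∉T bound)
    ... | no noCrossing | _ with M ⊆? T
    ...   | yes M⊆T = yes (subst (Connected G) (⊆-antisym T⊆M M⊆T) cT)
    ...   | no M⊈T = no λ cM → M⊈T (noCrossingEdge⇒⊆ cM t∈T (T⊆M t∈T) noCrossing)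

  nonCutVertex : Connected G M → Connected G T → t ∈ T → T ⊆ M → y ∈ M → y ∉ T →
                 ∃ λ z → z ∈ M × z ∉ T × Connected G (M - z)
  nonCutVertex {M} cM cT t∈T T⊆M y∈M y∉T =
    go cT t∈T T⊆M y∈M y∉T n (≤-trans (∣p∣≤n M) (m≤m+n n _))
    where
    -- z is the last vertex reached when T is grown to M along crossing edges.
    go : Connected G T → t ∈ T → T ⊆ M → y ∈ M → y ∉ T → ∀ f → ∣ M ∣ ≤ f + ∣ T ∣ →
         ∃ λ z → z ∈ M × z ∉ T × Connected G (M - z)
    go {T} {t} {m} cT t∈T T⊆M m∈M m∉T f bound
      with walk⇒crossingEdge (cM t m (T⊆M t∈T) m∈M) t∈T m∉T | f
    ... | _ , y , _ , y∈M , y∉T , _ | zero =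
      ⊥-elim (<⇒≱ (p⊂q⇒∣p∣<∣q∣ {q = M} (T⊆M , y , y∈M , y∉T)) bound)
    ... | a , y , a∈T , y∈M , y∉T , e | suc f with M ⊆? T ∪ ⁅ y ⁆
    ...   | yes M⊆T∪⁅y⁆ =
      y , y∈M , y∉T , subst (Connected G) (sym (p⊆q∪⁅x⁆⇒p-x≡q T⊆M y∉T M⊆T∪⁅y⁆)) cT
    ...   | no M⊈T∪⁅y⁆ =
      let m′ , m′∈M , m′∉T∪⁅y⁆ = ⊈⇒∃∉ M⊈T∪⁅y⁆
          z , z∈M , z∉T∪⁅y⁆ , cM-z = go (Connected-∪⁅⁆ cT a∈T e) (x∈p∪q⁺ (inj₁ t∈T))
                                        (p⊆q∧x∈q⇒p∪⁅x⁆⊆q T⊆M y∈M) m′∈M m′∉T∪⁅y⁆ f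
                                        (∣q∣≤1+f+∣p∣⇒∣q∣≤f+∣p∪⁅x⁆∣ {q = M} y∉T bound)
      in z , z∈M , z∉T∪⁅y⁆ ∘ x∈p∪q⁺ ∘ inj₁ , cM-z

  connected-neighbour : Connected G W → x ∈ W → 2 ≤ ∣ W ∣ → ∃ λ y → y ∈ W × adj G x y ≡ true
  connected-neighbour {W} {x} cW x∈W 2≤∣W∣ with W ⊆? ⁅ x ⁆
  ... | yes W⊆⁅x⁆ = ⊥-elim (<⇒≱ 2≤∣W∣ (subst (∣ W ∣ ≤_) (∣⁅x⁆∣≡1 x) (p⊆q⇒∣p∣≤∣q∣ W⊆⁅x⁆)))
  ... | no W⊈⁅x⁆ with ⊈⇒∃∉ W⊈⁅x⁆
  ...   | u , u∈W , u∉⁅x⁆ with cW x u x∈W u∈W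
  ...     | here _ = ⊥-elim (u∉⁅x⁆ (x∈⁅x⁆ x))
  ...     | step _ e p = _ , walk-source p , e

  isolated∉connected : Connected G M → 2 ≤ ∣ M ∣ → M ⊆ W ∪ ⁅ x ⁆ →
                       (∀ {w} → w ∈ W → adj G x w ≡ false) → x ∉ M
  isolated∉connected {M} {W} {x} cM 2≤∣M∣ M⊆W∪⁅x⁆ isolated x∈M
    with connected-neighbour cM x∈M 2≤∣M∣
  ... | b , b∈M , e with x∈p∪⁅y⁆⁻ (M⊆W∪⁅x⁆ b∈M)
  ...   | inj₁ b∈W = Bool.not-¬ e (isolated b∈W)
  ...   | inj₂ refl = Bool.not-¬ e (irrefl G x)

link-resp-≐ : Δ ≐ Δ′ → ∀ x → link Δ x ≐ link Δ′ x
link-resp-≐ (Δ⊆Δ′ , Δ′⊆Δ) x = map₂ Δ⊆Δ′ , map₂ Δ′⊆Δ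

deletion-resp-≐ : Δ ≐ Δ′ → ∀ x → deletion Δ x ≐ deletion Δ′ x
deletion-resp-≐ (Δ⊆Δ′ , Δ′⊆Δ) x = map₂ Δ⊆Δ′ , map₂ Δ′⊆Δ

IsFacet-resp-≐ : ∀ {F} → Δ ≐ Δ′ → IsFacet Δ F → IsFacet Δ′ F
IsFacet-resp-≐ (Δ⊆Δ′ , Δ′⊆Δ) (F∈Δ , maximal) = Δ⊆Δ′ F∈Δ , λ τ → maximal τ ∘ Δ′⊆Δ

IsSimplex-resp-≐ : Δ ≐ Δ′ → IsSimplex Δ → IsSimplex Δ′
IsSimplex-resp-≐ (Δ⊆Δ′ , Δ′⊆Δ) (F , faces) =
  F , λ σ → proj₁ (faces σ) ∘ Δ′⊆Δ , Δ⊆Δ′ ∘ proj₂ (faces σ)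

VertexDecomposable-resp-≐ : Δ ≐ Δ′ → VertexDecomposable Δ → VertexDecomposable Δ′
VertexDecomposable-resp-≐ Δ≐Δ′ (simplex isSimplex) = simplex (IsSimplex-resp-≐ Δ≐Δ′ isSimplex)
VertexDecomposable-resp-≐ (_ , Δ′⊆Δ) (void noFace) = void λ σ → noFace σ ∘ Δ′⊆Δ
VertexDecomposable-resp-≐ Δ≐Δ′ (shed x x∈Δ vdLink vdDeletion facets) =
  shed x (proj₁ Δ≐Δ′ x∈Δ)
    (VertexDecomposable-resp-≐ (link-resp-≐ Δ≐Δ′ x) vdLink)
    (VertexDecomposable-resp-≐ (deletion-resp-≐ Δ≐Δ′ x) vdDeletion)
    (λ F → IsFacet-resp-≐ Δ≐Δ′ ∘ facets F ∘ IsFacet-resp-≐ (≐-sym (deletion-resp-≐ Δ≐Δ′ x)))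

module Circuits {n : ℕ} (G : Graph n) (r : ℕ) where

  open Connectivity G

  private
    variable
      U U′ S W W′ : Subset n
      x : Fin n

  module _ {V V′ : VSet n} (V⊆V′ : V ⊆ᵛ V′) where

    IsCircuit-mono : IsCircuit G r V W → IsCircuit G r V′ W
    IsCircuit-mono (W⊆V , ∣W∣≡r , cW) = (λ y → V⊆V′ ∘ W⊆V y) , ∣W∣≡r , cW

    AtMostOneCircuit-anti : AtMostOneCircuit G r V′ → AtMostOneCircuit G r V
    AtMostOneCircuit-anti atMostOne W W′ c c′ =
      atMostOne W W′ (IsCircuit-mono c) (IsCircuit-mono c′)

    NoCircuit-anti : NoCircuit G r V′ → NoCircuit G r V
    NoCircuit-anti none W = none W ∘ IsCircuit-mono

  Circuit : Subset n → Subset n → Set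
  Circuit U = IsCircuit G r (_∈ U)

  circuit? : ∀ U W → Dec (Circuit U W)
  circuit? U W = all? (λ y → y ∈? W →-dec y ∈? U) ×-dec ∣ W ∣ ℕ.≟ r ×-dec connected? W

  circuit⊆ : Circuit U W → W ⊆ U
  circuit⊆ (W⊆U , _) = W⊆U _

  circuit-⊆⇒≡ : Circuit U W → Circuit U′ W′ → W ⊆ W′ → W ≡ W′
  circuit-⊆⇒≡ (_ , ∣W∣≡r , _) (_ , ∣W′∣≡r , _) W⊆W′ =
    ⊆∧∣q∣≤∣p∣⇒p≡q W⊆W′ (≤-reflexive (trans ∣W′∣≡r (sym ∣W∣≡r)))

  Disjoint : Subset n → Subset n → Set
  Disjoint σ W = ∀ x → x ∈ σ → x ∉ W

  Σᵣ : Subset n → Subset n → Complex n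
  Σᵣ U S σ = σ ⊆ U × ∃ λ W → Circuit U W × S ⊆ W × Disjoint σ W

  Σᵣ? : ∀ U S σ → Dec (Σᵣ U S σ)
  Σᵣ? U S σ = σ ⊆? U ×-dec anySubset? λ W →
    circuit? U W ×-dec S ⊆? W ×-dec all? (λ y → y ∈? σ →-dec ¬? (y ∈? W))

  Σᵣ-link : x ∈ U → link (Σᵣ U S) x ≐ Σᵣ (U - x) S
  Σᵣ-link {x} {U} {S} x∈U = to , from
    where
    to : ∀ {σ} → link (Σᵣ U S) x σ → Σᵣ (U - x) S σ
    to (x∉σ , σ∪⁅x⁆⊆U , W , (W⊆U , ∣W∣≡r , cW) , S⊆W , disjoint) =
      (λ y∈σ → x∈p∧x≢y⇒x∈p-y (σ∪⁅x⁆⊆U (x∈p∪q⁺ (inj₁ y∈σ))) λ { refl → x∉σ y∈σ }) ,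
      W , ((λ y y∈W → x∈p∧x≢y⇒x∈p-y (W⊆U y y∈W) λ { refl → x∉W y∈W }) , ∣W∣≡r , cW) , S⊆W ,
      λ y → disjoint y ∘ x∈p∪q⁺ ∘ inj₁
      where
      x∉W : x ∉ W
      x∉W = disjoint x (x∈p∪q⁺ (inj₂ (x∈⁅x⁆ x)))
    from : ∀ {σ} → Σᵣ (U - x) S σ → link (Σᵣ U S) x σ
    from (σ⊆U-x , W , (W⊆U-x , ∣W∣≡r , cW) , S⊆W , disjoint) =
      (λ x∈σ → proj₂ (x∈p-y⁻ (σ⊆U-x x∈σ)) refl) ,
      p⊆q∧x∈q⇒p∪⁅x⁆⊆q (proj₁ ∘ x∈p-y⁻ ∘ σ⊆U-x) x∈U ,
      W , ((λ y → proj₁ ∘ x∈p-y⁻ ∘ W⊆U-x y) , ∣W∣≡r , cW) , S⊆W , disjoint∪⁅x⁆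
      where
      disjoint∪⁅x⁆ : Disjoint (_ ∪ ⁅ x ⁆) W
      disjoint∪⁅x⁆ y y∈σ∪⁅x⁆ with x∈p∪⁅y⁆⁻ y∈σ∪⁅x⁆
      ... | inj₁ y∈σ = disjoint y y∈σ
      ... | inj₂ refl = λ x∈W → proj₂ (x∈p-y⁻ (W⊆U-x x x∈W)) refl

  CircuitExchange : Subset n → Subset n → Fin n → Subset n → Set
  CircuitExchange U S x W =
    ∃₂ λ z W′ → z ∈ W × z ∉ W′ × Circuit U W′ × S ∪ ⁅ x ⁆ ⊆ W′ × W′ ⊆ W ∪ ⁅ x ⁆

  Exchange : Subset n → Subset n → Fin n → Set
  Exchange U S x = ∀ {W} → Circuit U W → S ⊆ W → x ∉ W → CircuitExchange U S x W

  Σᵣ-deletion : Exchange U S x → deletion (Σᵣ U S) x ≐ Σᵣ U (S ∪ ⁅ x ⁆)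
  Σᵣ-deletion {U} {S} {x} exchange = to , from
    where
    to : ∀ {σ} → deletion (Σᵣ U S) x σ → Σᵣ U (S ∪ ⁅ x ⁆) σ
    to (x∉σ , σ⊆U , W , W-circuit , S⊆W , disjoint) with x ∈? W
    ... | yes x∈W = σ⊆U , W , W-circuit , p⊆q∧x∈q⇒p∪⁅x⁆⊆q S⊆W x∈W , disjoint
    ... | no x∉W =
      let _ , W′ , _ , _ , W′-circuit , S∪⁅x⁆⊆W′ , W′⊆W∪⁅x⁆ = exchange W-circuit S⊆W x∉W
      in σ⊆U , W′ , W′-circuit , S∪⁅x⁆⊆W′ , λ y y∈σ y∈W′ →
           [ disjoint y y∈σ , (λ { refl → x∉σ y∈σ }) ]′ (x∈p∪⁅y⁆⁻ (W′⊆W∪⁅x⁆ y∈W′))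
    from : ∀ {σ} → Σᵣ U (S ∪ ⁅ x ⁆) σ → deletion (Σᵣ U S) x σ
    from (σ⊆U , W , W-circuit , S∪⁅x⁆⊆W , disjoint) =
      (λ x∈σ → disjoint x x∈σ (S∪⁅x⁆⊆W (x∈p∪q⁺ (inj₂ (x∈⁅x⁆ x))))) ,
      σ⊆U , W , W-circuit , S∪⁅x⁆⊆W ∘ x∈p∪q⁺ ∘ inj₁ , disjoint

  Σᵣ-swap : ∀ {τ} → Exchange U S x → Σᵣ U S τ → x ∈ τ →
            ∃ λ z → z ∉ τ × deletion (Σᵣ U S) x ((τ - x) ∪ ⁅ z ⁆)
  Σᵣ-swap {U} {S} {x} {τ} exchange (τ⊆U , W , W-circuit , S⊆W , disjoint) x∈τ =
    let z , W′ , z∈W , z∉W′ , W′-circuit , S∪⁅x⁆⊆W′ , W′⊆W∪⁅x⁆ = exchange W-circuit S⊆W x∉W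
    in z , (λ z∈τ → disjoint z z∈τ z∈W) ,
       x∉τ′ z∈W , p⊆q∧x∈q⇒p∪⁅x⁆⊆q (τ⊆U ∘ proj₁ ∘ x∈p-y⁻) (circuit⊆ W-circuit z∈W) ,
       W′ , W′-circuit , S∪⁅x⁆⊆W′ ∘ x∈p∪q⁺ ∘ inj₁ , disjoint′ z∉W′ W′⊆W∪⁅x⁆
    where
    x∉W : x ∉ W
    x∉W = disjoint x x∈τ
    x∉τ′ : ∀ {z} → z ∈ W → x ∉ (τ - x) ∪ ⁅ z ⁆
    x∉τ′ z∈W x∈τ′ with x∈p∪⁅y⁆⁻ x∈τ′
    ... | inj₁ x∈τ-x = proj₂ (x∈p-y⁻ x∈τ-x) refl
    ... | inj₂ refl = x∉W z∈W
    disjoint′ : ∀ {z W′} → z ∉ W′ → W′ ⊆ W ∪ ⁅ x ⁆ → Disjoint ((τ - x) ∪ ⁅ z ⁆) W′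
    disjoint′ z∉W′ W′⊆W∪⁅x⁆ y y∈τ′ y∈W′ with x∈p∪⁅y⁆⁻ y∈τ′ | x∈p∪⁅y⁆⁻ (W′⊆W∪⁅x⁆ y∈W′)
    ... | inj₂ refl | _ = z∉W′ y∈W′
    ... | inj₁ y∈τ-x | inj₁ y∈W = disjoint y (proj₁ (x∈p-y⁻ y∈τ-x)) y∈W
    ... | inj₁ y∈τ-x | inj₂ y≡x = proj₂ (x∈p-y⁻ y∈τ-x) y≡x

  Σᵣ-deletion-facet : ∀ {F} → Exchange U S x → IsFacet (deletion (Σᵣ U S) x) F → IsFacet (Σᵣ U S) F
  Σᵣ-deletion-facet {U} {S} {x} {F} exchange ((x∉F , F∈Σ) , maximal) = F∈Σ , maximalΣ
    where
    maximalΣ : ∀ τ → Σᵣ U S τ → F ⊆ τ → τ ⊆ F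
    maximalΣ τ τ∈Σ F⊆τ with x ∈? τ
    ... | no x∉τ = maximal τ (x∉τ , τ∈Σ) F⊆τ
    ... | yes x∈τ =
      let z , z∉τ , τ′∈deletion = Σᵣ-swap exchange τ∈Σ x∈τ
      in ⊥-elim (z∉τ (F⊆τ (maximal _ τ′∈deletion (p⊆p∪q ⁅ z ⁆ ∘ F⊆τ-x) (x∈p∪q⁺ (inj₂ (x∈⁅x⁆ z))))))
      where
      F⊆τ-x : F ⊆ τ - x
      F⊆τ-x y∈F = x∈p∧x≢y⇒x∈p-y (F⊆τ y∈F) λ { refl → x∉F y∈F }

  Σᵣ-∪⁅⁆-redundant : x ∈ U → ¬ Σᵣ U S ⁅ x ⁆ → Σᵣ U (S ∪ ⁅ x ⁆) ≐ Σᵣ U S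
  Σᵣ-∪⁅⁆-redundant {x} {U} {S} x∈U x∉Σ = to , from
    where
    to : ∀ {σ} → Σᵣ U (S ∪ ⁅ x ⁆) σ → Σᵣ U S σ
    to (σ⊆U , W , W-circuit , S∪⁅x⁆⊆W , disjoint) =
      σ⊆U , W , W-circuit , S∪⁅x⁆⊆W ∘ x∈p∪q⁺ ∘ inj₁ , disjoint
    from : ∀ {σ} → Σᵣ U S σ → Σᵣ U (S ∪ ⁅ x ⁆) σ
    from (σ⊆U , W , W-circuit , S⊆W , disjoint) =
      σ⊆U , W , W-circuit , p⊆q∧x∈q⇒p∪⁅x⁆⊆q S⊆W x∈W , disjoint
      where
      x∈W : x ∈ W
      x∈W = decidable-stable (x ∈? W) λ x∉W → x∉Σ (x∈p⇒⁅x⁆⊆p x∈U , W , W-circuit , S⊆W ,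
        λ y y∈⁅x⁆ → subst (_∉ W) (sym (x∈⁅y⁆⇒x≡y x y∈⁅x⁆)) x∉W)

  Σᵣ-extend : x ∈ U → Exchange U S x →
              VertexDecomposable (Σᵣ (U - x) S) → VertexDecomposable (Σᵣ U (S ∪ ⁅ x ⁆)) →
              VertexDecomposable (Σᵣ U S)
  Σᵣ-extend {x} {U} {S} x∈U exchange vdLink vdDeletion with Σᵣ? U S ⁅ x ⁆
  ... | yes x∈Σ = shed x x∈Σ
    (VertexDecomposable-resp-≐ (≐-sym (Σᵣ-link x∈U)) vdLink)
    (VertexDecomposable-resp-≐ (≐-sym (Σᵣ-deletion exchange)) vdDeletion)
    (λ F → Σᵣ-deletion-facet exchange)
  ... | no x∉Σ = VertexDecomposable-resp-≐ (Σᵣ-∪⁅⁆-redundant x∈U x∉Σ) vdDeletion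

  circuit-exchange : ∀ {w m} → Connected G (S ∪ ⁅ x ⁆) → Circuit U W → S ⊆ W → x ∈ U → x ∉ W →
                     w ∈ W → adj G w x ≡ true → m ∈ W → m ∉ S → CircuitExchange U S x W
  circuit-exchange {S} {x} {U} {W} {m = m} cT (W⊆U , ∣W∣≡r , cW) S⊆W x∈U x∉W w∈W e m∈W m∉S =
    let z , z∈M , z∉T , cM-z = nonCutVertex (Connected-∪⁅⁆ cW w∈W e) cT x∈T T⊆M (p⊆p∪q _ m∈W) m∉T
    in z , M - z , z∈W z∈M z∉T , (λ z∈M-z → proj₂ (x∈p-y⁻ z∈M-z) refl) ,
       ((λ _ → M⊆U ∘ proj₁ ∘ x∈p-y⁻) , ∣M-z∣≡r z∈M , cM-z) , T⊆M-z z∉T , proj₁ ∘ x∈p-y⁻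
    where
    M T : Subset n
    M = W ∪ ⁅ x ⁆
    T = S ∪ ⁅ x ⁆
    x∈T : x ∈ T
    x∈T = x∈p∪q⁺ (inj₂ (x∈⁅x⁆ x))
    T⊆M : T ⊆ M
    T⊆M = p⊆q∧x∈q⇒p∪⁅x⁆⊆q (p⊆p∪q _ ∘ S⊆W) (x∈p∪q⁺ (inj₂ (x∈⁅x⁆ x)))
    M⊆U : M ⊆ U
    M⊆U = p⊆q∧x∈q⇒p∪⁅x⁆⊆q (W⊆U _) x∈U
    m∉T : m ∉ T
    m∉T m∈T = [ m∉S , (λ { refl → x∉W m∈W }) ]′ (x∈p∪⁅y⁆⁻ m∈T)
    z∈W : ∀ {z} → z ∈ M → z ∉ T → z ∈ W
    z∈W z∈M z∉T = [ id , (λ { refl → ⊥-elim (z∉T x∈T) }) ]′ (x∈p∪⁅y⁆⁻ z∈M)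
    T⊆M-z : ∀ {z} → z ∉ T → T ⊆ M - z
    T⊆M-z z∉T y∈T = x∈p∧x≢y⇒x∈p-y (T⊆M y∈T) λ { refl → z∉T y∈T }
    ∣M-z∣≡r : ∀ {z} → z ∈ M → ∣ M - z ∣ ≡ r
    ∣M-z∣≡r {z} z∈M = suc-injective (begin
      suc ∣ M - z ∣  ≡⟨ x∈p⇒∣p∣≡1+∣p-x∣ z∈M ⟨
      ∣ M ∣          ≡⟨ x∉p⇒∣p∪⁅x⁆∣≡1+∣p∣ x∉W ⟩
      suc ∣ W ∣      ≡⟨ cong suc ∣W∣≡r ⟩
      suc r          ∎)
      where open ≡-Reasoning

  Σᵣ-simplex : ∀ {W₀} → Circuit U W₀ → S ⊆ W₀ → (∀ {W} → Circuit U W → S ⊆ W → W ≡ W₀) →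
               IsSimplex (Σᵣ U S)
  Σᵣ-simplex {U} {S} {W₀} W₀-circuit S⊆W₀ unique = U ─ W₀ , λ σ → face⊆ , ⊆face
    where
    face⊆ : ∀ {σ} → Σᵣ U S σ → σ ⊆ U ─ W₀
    face⊆ (σ⊆U , W , W-circuit , S⊆W , disjoint) y∈σ =
      x∈p∧x∉q⇒x∈p─q (σ⊆U y∈σ) (subst (_ ∉_) (unique W-circuit S⊆W) (disjoint _ y∈σ))
    ⊆face : ∀ {σ} → σ ⊆ U ─ W₀ → Σᵣ U S σ
    ⊆face σ⊆U─W₀ = proj₁ ∘ x∈p─q⁻ U W₀ ∘ σ⊆U─W₀ , W₀ , W₀-circuit , S⊆W₀ ,
                   λ _ → proj₂ ∘ x∈p─q⁻ U W₀ ∘ σ⊆U─W₀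

  atMostOneCircuit⇒Σᵣ-vertexDecomposable : AtMostOneCircuit G r (_∈ U) → VertexDecomposable (Σᵣ U S)
  atMostOneCircuit⇒Σᵣ-vertexDecomposable {U} {S} atMostOne
    with anySubset? (λ W → circuit? U W ×-dec S ⊆? W)
  ... | yes (W₀ , W₀-circuit , S⊆W₀) =
    simplex (Σᵣ-simplex W₀-circuit S⊆W₀ λ W-circuit _ → atMostOne _ _ W-circuit W₀-circuit)
  ... | no none = void λ σ (_ , W , W-circuit , S⊆W , _) → none (W , W-circuit , S⊆W)

  connected⇒Σᵣ-vertexDecomposable : ∀ {s} → Connected G S → s ∈ S → S ⊆ U →
                                    VertexDecomposable (Σᵣ U S)
  connected⇒Σᵣ-vertexDecomposable {S} {U} cS s∈S S⊆U =
    go cS s∈S S⊆U n (≤-trans (∣p∣≤n U) (m≤m+n n _))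
    where
    W⊈S : ∀ {U S W} → ∣ S ∣ ≢ r → Circuit U W → S ⊆ W → ¬ W ⊆ S
    W⊈S ∣S∣≢r (_ , ∣W∣≡r , _) S⊆W W⊆S = ∣S∣≢r (trans (cong ∣_∣ (⊆-antisym S⊆W W⊆S)) ∣W∣≡r)
    go : ∀ {U S s} → Connected G S → s ∈ S → S ⊆ U → ∀ f → ∣ U ∣ ≤ f + ∣ S ∣ →
         VertexDecomposable (Σᵣ U S)
    go {U} {S} {s} cS s∈S S⊆U f bound with ∣ S ∣ ℕ.≟ r | crossingEdge? S U | f
    ... | yes ∣S∣≡r | _ | _ =
      simplex (Σᵣ-simplex S-circuit id λ W-circuit S⊆W → sym (circuit-⊆⇒≡ S-circuit W-circuit S⊆W))
      where
      S-circuit : Circuit U S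
      S-circuit = (λ _ → S⊆U) , ∣S∣≡r , cS
    ... | no ∣S∣≢r | no noCrossing | _ = void λ σ (_ , W , W-circuit@(_ , _ , cW) , S⊆W , _) →
      W⊈S ∣S∣≢r W-circuit S⊆W (noCrossingEdge⇒⊆ cW s∈S (S⊆W s∈S) λ (a , y , a∈S , y∈W , y∉S , e) →
        noCrossing (a , y , a∈S , circuit⊆ W-circuit y∈W , y∉S , e))
    ... | no _ | yes (_ , y , _ , y∈U , y∉S , _) | zero =
      ⊥-elim (<⇒≱ (p⊂q⇒∣p∣<∣q∣ {q = U} (S⊆U , y , y∈U , y∉S)) bound)
    ... | no ∣S∣≢r | yes (a , y , a∈S , y∈U , y∉S , e) | suc f =
      Σᵣ-extend y∈U exchange
        (go cS s∈S S⊆U-y f (≤-pred (subst (_≤ suc (f + ∣ S ∣)) (x∈p⇒∣p∣≡1+∣p-x∣ y∈U) bound)))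
        (go (Connected-∪⁅⁆ cS a∈S e) (p⊆p∪q _ s∈S) (p⊆q∧x∈q⇒p∪⁅x⁆⊆q S⊆U y∈U) f
            (∣q∣≤1+f+∣p∣⇒∣q∣≤f+∣p∪⁅x⁆∣ {q = U} y∉S bound))
      where
      S⊆U-y : S ⊆ U - y
      S⊆U-y x∈S = x∈p∧x≢y⇒x∈p-y (S⊆U x∈S) λ { refl → y∉S x∈S }
      exchange : Exchange U S y
      exchange W-circuit S⊆W y∉W =
        let m , m∈W , m∉S = ⊈⇒∃∉ (W⊈S ∣S∣≢r W-circuit S⊆W)
        in circuit-exchange (Connected-∪⁅⁆ cS a∈S e) W-circuit S⊆W y∈U y∉W (S⊆W a∈S) e m∈W m∉S

  -- (1) ⇒ (2)

  SheddingOrder : ∀ {k} → Subset n → (Fin k → Fin n) → Set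
  SheddingOrder {k} U xs =
    (∀ i → NoCircuit G r ((_∈ U) ∩ RemainingMinusNbhd G xs i))
    × AtMostOneCircuit G r ((_∈ U) ∩ Remaining xs k)

  SheddingOrder-tail : ∀ {k} {xs : Fin (suc k) → Fin n} → U′ ⊆ U → xs zero ∉ U′ →
                       SheddingOrder U xs → SheddingOrder U′ (xs ∘ suc)
  SheddingOrder-tail {U′} {U} {xs = xs} U′⊆U x∉U′ (noCircuit , atMostOne) =
    (λ i → NoCircuit-anti (λ (y∈U′ , R , rest) → let y∈U , R′ = widen (y∈U′ , R) in y∈U , R′ , rest)
                          (noCircuit (suc i))) ,
    AtMostOneCircuit-anti widen atMostOne
    where
    widen : ∀ {t y} → y ∈ U′ × Remaining (xs ∘ suc) t y → y ∈ U × Remaining xs (suc t) y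
    widen (y∈U′ , R) = U′⊆U y∈U′ , remaining-suc (λ { refl → x∉U′ y∈U′ }) R

  sheddingOrder⇒Σᵣ-vertexDecomposable : ∀ {k} (xs : Fin k → Fin n) →
    SheddingOrder U xs → VertexDecomposable (Σᵣ U ∅)
  sheddingOrder⇒Σᵣ-vertexDecomposable {k = zero} xs (_ , atMostOne) =
    atMostOneCircuit⇒Σᵣ-vertexDecomposable (AtMostOneCircuit-anti (λ y∈U → y∈U , λ ()) atMostOne)
  sheddingOrder⇒Σᵣ-vertexDecomposable {U} {suc k} xs order with xs zero ∈? U
  -- No injectivity is needed: a vertex that is already gone is skipped.
  ... | no x∉U = sheddingOrder⇒Σᵣ-vertexDecomposable (xs ∘ suc) (SheddingOrder-tail id x∉U order)
  ... | yes x∈U =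
    Σᵣ-extend x∈U exchange
      (sheddingOrder⇒Σᵣ-vertexDecomposable (xs ∘ suc)
        (SheddingOrder-tail (proj₁ ∘ x∈p-y⁻) x∉U-x order))
      (connected⇒Σᵣ-vertexDecomposable c⁅x⁆ (q⊆p∪q ∅ _ (x∈⁅x⁆ (xs zero)))
        (p⊆q∧x∈q⇒p∪⁅x⁆⊆q (⊆-min U) x∈U))
    where
    c⁅x⁆ : Connected G (∅ ∪ ⁅ xs zero ⁆)
    c⁅x⁆ = subst (Connected G) (sym (∪-identityˡ _)) Connected-⁅⁆
    x∉U-x : xs zero ∉ U - xs zero
    x∉U-x x∈U-x = proj₂ (x∈p-y⁻ x∈U-x) refl
    exchange : Exchange U ∅ (xs zero)
    exchange {W} W-circuit@(W⊆U , ∣W∣≡r , cW) _ x∉W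
      with any? (λ w → w ∈? W ×-dec adj G (xs zero) w Bool.≟ true)
    ... | yes (w , w∈W , e) =
      circuit-exchange c⁅x⁆ W-circuit (⊆-min W) x∈U x∉W w∈W (trans (Graph.sym G w (xs zero)) e)
        w∈W ∉⊥
    ... | no noNeighbour = ⊥-elim (proj₁ order zero W (W⊆U∖N[x] , ∣W∣≡r , cW))
      where
      W⊆U∖N[x] : ∀ y → y ∈ W → y ∈ U × RemainingMinusNbhd G xs zero y
      W⊆U∖N[x] y y∈W = W⊆U y y∈W , (λ _ ()) , (λ { refl → x∉W y∈W }) ,
                       Bool.¬-not (λ e → noNeighbour (y , y∈W , e))

  -- (2) ⇒ (1)

  _∖N[_] : Subset n → Fin n → VSet n
  (U ∖N[ x ]) y = y ∈ U × x ≢ y × adj G x y ≡ false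

  sheddingVertex⇒noCircuit : 2 ≤ r → x ∈ U →
    (∀ F → IsFacet (deletion (Σᵣ U ∅) x) F → IsFacet (Σᵣ U ∅) F) → NoCircuit G r (U ∖N[ x ])
  sheddingVertex⇒noCircuit {x} {U} 2≤r x∈U facets W W-circuit′@(W⊆U∖N[x] , _) =
    ∉F x (proj₂ (facets F F-facet) (U ─ W) U─W∈Σ F⊆U─W (x∈p∧x∉q⇒x∈p─q x∈U x∉W)) refl
    where
    F : Subset n
    F = U ─ W - x
    ∈F : ∀ y → y ∈ U → y ∉ W → y ≢ x → y ∈ F
    ∈F y y∈U y∉W = x∈p∧x≢y⇒x∈p-y (x∈p∧x∉q⇒x∈p─q y∈U y∉W)
    ∉F : ∀ y → y ∈ F → y ≢ x
    ∉F y = proj₂ ∘ x∈p-y⁻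
    F⊆U─W : F ⊆ U ─ W
    F⊆U─W = proj₁ ∘ x∈p-y⁻
    W-circuit : Circuit U W
    W-circuit = IsCircuit-mono proj₁ W-circuit′
    x∉W : x ∉ W
    x∉W x∈W = proj₁ (proj₂ (W⊆U∖N[x] x x∈W)) refl
    U─W∈Σ : Σᵣ U ∅ (U ─ W)
    U─W∈Σ = proj₁ ∘ x∈p─q⁻ U W , W , W-circuit , ⊆-min W , λ _ → proj₂ ∘ x∈p─q⁻ U W
    maximal : ∀ τ → deletion (Σᵣ U ∅) x τ → F ⊆ τ → τ ⊆ F
    maximal τ (x∉τ , τ⊆U , W′ , W′-circuit@(_ , ∣W′∣≡r , cW′) , _ , disjoint) F⊆τ {y} y∈τ =
      ∈F y (τ⊆U y∈τ) (subst (y ∉_) W′≡W (disjoint y y∈τ)) λ { refl → x∉τ y∈τ }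
      where
      W′⊆W∪⁅x⁆ : W′ ⊆ W ∪ ⁅ x ⁆
      W′⊆W∪⁅x⁆ {v} v∈W′ with v ∈? W | v ≟ x
      ... | yes v∈W | _ = x∈p∪q⁺ (inj₁ v∈W)
      ... | no _ | yes refl = x∈p∪q⁺ (inj₂ (x∈⁅x⁆ x))
      ... | no v∉W | no v≢x =
        ⊥-elim (disjoint v (F⊆τ (∈F v (circuit⊆ W′-circuit v∈W′) v∉W v≢x)) v∈W′)
      x∉W′ : x ∉ W′
      x∉W′ = isolated∉connected cW′ (subst (2 ≤_) (sym ∣W′∣≡r) 2≤r) W′⊆W∪⁅x⁆
               (λ w∈W → proj₂ (proj₂ (W⊆U∖N[x] _ w∈W)))
      W′≡W : W′ ≡ W
      W′≡W = circuit-⊆⇒≡ W′-circuit W-circuit λ v∈W′ →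
        [ id , (λ { refl → ⊥-elim (x∉W′ v∈W′) }) ]′ (x∈p∪⁅y⁆⁻ (W′⊆W∪⁅x⁆ v∈W′))
    F-facet : IsFacet (deletion (Σᵣ U ∅) x) F
    F-facet = ((λ x∈F → ∉F x x∈F refl) ,
               proj₁ U─W∈Σ ∘ F⊆U─W , W , W-circuit , ⊆-min W , λ _ → proj₂ ∘ x∈p─q⁻ U W ∘ F⊆U─W) ,
              maximal

  MinimalSheddingOrder : ∀ {k} → Subset n → (Fin k → Fin n) → Set
  MinimalSheddingOrder {k} U xs =
    Injective xs × (∀ j → xs j ∈ U) × SheddingOrder U xs
    × (∀ j → 1 ≤ j → j < k → ¬ AtMostOneCircuit G r ((_∈ U) ∩ Remaining xs j))

  minimalSheddingOrder-[] : AtMostOneCircuit G r (_∈ U) → MinimalSheddingOrder U Vector.[]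
  minimalSheddingOrder-[] atMostOne =
    (λ ()) , (λ ()) , ((λ ()) , AtMostOneCircuit-anti proj₁ atMostOne) , λ _ _ ()

  minimalSheddingOrder-∷ : ∀ {k} {xs : Fin k → Fin n} → x ∈ U → NoCircuit G r (U ∖N[ x ]) →
    (1 ≤ k → ¬ AtMostOneCircuit G r (_∈ U - x)) →
    MinimalSheddingOrder (U - x) xs → MinimalSheddingOrder U (x Vector.∷ xs)
  minimalSheddingOrder-∷ {x} {U} {k} {xs} x∈U noCircuit notAtMostOne
                         (injective , xs∈U-x , (noCircuits , atMostOne) , minimal) =
    injective′ , xs′∈U , (noCircuits′ , AtMostOneCircuit-anti shift atMostOne) , minimal′
    where
    shift : ∀ {t y} → y ∈ U × Remaining (x Vector.∷ xs) (suc t) y → y ∈ U - x × Remaining xs t y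
    shift (y∈U , R) = let x≢y , R′ = remaining-suc⁻ R in x∈p∧x≢y⇒x∈p-y y∈U (x≢y ∘ sym) , R′
    unshift : ∀ {t y} → y ∈ U - x × Remaining xs t y → y ∈ U × Remaining (x Vector.∷ xs) (suc t) y
    unshift (y∈U-x , R) = let y∈U , y≢x = x∈p-y⁻ y∈U-x in y∈U , remaining-suc (y≢x ∘ sym) R
    x≢xs : ∀ j → x ≢ xs j
    x≢xs j x≡xs[j] = proj₂ (x∈p-y⁻ (xs∈U-x j)) (sym x≡xs[j])
    injective′ : Injective (x Vector.∷ xs)
    injective′ zero zero _ = refl
    injective′ zero (suc j) x≡xs[j] = ⊥-elim (x≢xs j x≡xs[j])
    injective′ (suc i) zero xs[i]≡x = ⊥-elim (x≢xs i (sym xs[i]≡x))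
    injective′ (suc i) (suc j) xs[i]≡xs[j] = cong suc (injective i j xs[i]≡xs[j])
    xs′∈U : ∀ j → (x Vector.∷ xs) j ∈ U
    xs′∈U zero = x∈U
    xs′∈U (suc j) = proj₁ (x∈p-y⁻ (xs∈U-x j))
    noCircuits′ : ∀ i → NoCircuit G r ((_∈ U) ∩ RemainingMinusNbhd G (x Vector.∷ xs) i)
    noCircuits′ zero = NoCircuit-anti (λ (y∈U , _ , rest) → y∈U , rest) noCircuit
    noCircuits′ (suc i) =
      NoCircuit-anti (λ (y∈U , R , rest) → let y∈U-x , R′ = shift (y∈U , R) in y∈U-x , R′ , rest)
                     (noCircuits i)
    minimal′ : ∀ j → 1 ≤ j → j < suc k →
               ¬ AtMostOneCircuit G r ((_∈ U) ∩ Remaining (x Vector.∷ xs) j)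
    minimal′ (suc zero) _ (s≤s 1≤k) =
      notAtMostOne 1≤k ∘ AtMostOneCircuit-anti (λ y∈U-x → unshift {t = 0} (y∈U-x , λ _ ()))
    minimal′ (suc (suc j)) _ (s≤s j<k) =
      minimal (suc j) (s≤s z≤n) j<k ∘ AtMostOneCircuit-anti unshift

  Condition1In : Subset n → Set
  Condition1In U = AtMostOneCircuit G r (_∈ U)
                 ⊎ ∃₂ λ k (xs : Fin k → Fin n) → 1 ≤ k × MinimalSheddingOrder U xs

  atMostOneCircuit? : ∀ U → Dec (AtMostOneCircuit G r (_∈ U))
  atMostOneCircuit? U with anySubset? (λ W → anySubset? λ W′ →
                             circuit? U W ×-dec circuit? U W′ ×-dec ¬? (≡-dec Bool._≟_ W W′))
  ... | yes (W , W′ , W-circuit , W′-circuit , W≢W′) =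
    no λ atMostOne → W≢W′ (atMostOne W W′ W-circuit W′-circuit)
  ... | no none = yes λ W W′ W-circuit W′-circuit →
    decidable-stable (≡-dec Bool._≟_ W W′) λ W≢W′ → none (W , W′ , W-circuit , W′-circuit , W≢W′)

  condition1In-shed : x ∈ U → NoCircuit G r (U ∖N[ x ]) → Condition1In (U - x) → Condition1In U
  condition1In-shed {x} {U} x∈U noCircuit condition with atMostOneCircuit? (U - x) | condition
  ... | yes atMostOne | _ =
    inj₂ (1 , _ , s≤s z≤n ,
          minimalSheddingOrder-∷ x∈U noCircuit (λ ()) (minimalSheddingOrder-[] atMostOne))
  ... | no notAtMostOne | inj₁ atMostOne = ⊥-elim (notAtMostOne atMostOne)
  ... | no notAtMostOne | inj₂ (k , _ , _ , order) =
    inj₂ (suc k , _ , s≤s z≤n , minimalSheddingOrder-∷ x∈U noCircuit (λ _ → notAtMostOne) order)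

  Σᵣ-simplex⇒atMostOneCircuit : IsSimplex (Σᵣ U ∅) → AtMostOneCircuit G r (_∈ U)
  Σᵣ-simplex⇒atMostOneCircuit {U} (F , faces) W₁ W₂ W₁-circuit W₂-circuit with proj₂ (faces F) id
  ... | _ , W₀ , W₀-circuit , _ , disjoint = trans (sym (W₀≡ W₁-circuit)) (W₀≡ W₂-circuit)
    where
    W₀≡ : ∀ {W} → Circuit U W → W₀ ≡ W
    W₀≡ {W} W-circuit = circuit-⊆⇒≡ W₀-circuit W-circuit λ {y} y∈W₀ →
      decidable-stable (y ∈? W) λ y∉W →
        disjoint y (U─W⊆F (x∈p∧x∉q⇒x∈p─q (circuit⊆ W₀-circuit y∈W₀) y∉W)) y∈W₀
      where
      U─W⊆F : U ─ W ⊆ F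
      U─W⊆F = proj₁ (faces (U ─ W))
                (proj₁ ∘ x∈p─q⁻ U W , W , W-circuit , ⊆-min W , λ _ → proj₂ ∘ x∈p─q⁻ U W)

  vertexDecomposable⇒condition1In : 2 ≤ r → ∀ {Δ} → VertexDecomposable Δ → Δ ≐ Σᵣ U ∅ →
                                    Condition1In U
  vertexDecomposable⇒condition1In _ (simplex isSimplex) Δ≐Σ =
    inj₁ (Σᵣ-simplex⇒atMostOneCircuit (IsSimplex-resp-≐ Δ≐Σ isSimplex))
  vertexDecomposable⇒condition1In _ (void noFace) (_ , Σ⊆Δ) = inj₁ λ W _ W-circuit _ →
    ⊥-elim (noFace ∅ (Σ⊆Δ (⊆-min _ , W , W-circuit , ⊆-min W , λ _ → ⊥-elim ∘ ∉⊥)))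
  vertexDecomposable⇒condition1In {U} 2≤r (shed x x∈Δ vdLink _ facets) Δ≐Σ@(Δ⊆Σ , _) =
    condition1In-shed x∈U (sheddingVertex⇒noCircuit 2≤r x∈U facetsΣ)
      (vertexDecomposable⇒condition1In 2≤r vdLink (≐-trans (link-resp-≐ Δ≐Σ x) (Σᵣ-link x∈U)))
    where
    x∈U : x ∈ U
    x∈U = proj₁ (Δ⊆Σ x∈Δ) (x∈⁅x⁆ x)
    facetsΣ : ∀ F → IsFacet (deletion (Σᵣ U ∅) x) F → IsFacet (Σᵣ U ∅) F
    facetsΣ F = IsFacet-resp-≐ Δ≐Σ ∘ facets F ∘ IsFacet-resp-≐ (deletion-resp-≐ (≐-sym Δ≐Σ) x)

  SigmaR≐Σᵣ : SigmaR G r ≐ Σᵣ ⊤ ∅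
  SigmaR≐Σᵣ =
    (λ (W , W-circuit , disjoint) →
       ⊆⊤ , W , IsCircuit-mono (λ _ → ∈⊤) W-circuit , ⊆-min W , disjoint) ,
    (λ (_ , W , W-circuit , _ , disjoint) → W , IsCircuit-mono (λ _ → tt) W-circuit , disjoint)

  condition1⇒Σᵣ-vertexDecomposable : Condition1 G r → VertexDecomposable (Σᵣ ⊤ ∅)
  condition1⇒Σᵣ-vertexDecomposable (inj₁ atMostOne) =
    atMostOneCircuit⇒Σᵣ-vertexDecomposable (AtMostOneCircuit-anti (λ _ → tt) atMostOne)
  condition1⇒Σᵣ-vertexDecomposable (inj₂ (_ , xs , _ , _ , noCircuits , atMostOne , _)) =
    sheddingOrder⇒Σᵣ-vertexDecomposable xs
      ((λ i → NoCircuit-anti proj₂ (noCircuits i)) , AtMostOneCircuit-anti proj₂ atMostOne)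

  condition1In-⊤⇒condition1 : Condition1In ⊤ → Condition1 G r
  condition1In-⊤⇒condition1 (inj₁ atMostOne) = inj₁ (AtMostOneCircuit-anti (λ _ → ∈⊤) atMostOne)
  condition1In-⊤⇒condition1
    (inj₂ (k , xs , 1≤k , injective , _ , (noCircuits , atMostOne) , minimal)) =
    inj₂ (k , xs , 1≤k , injective , (λ i → NoCircuit-anti (∈⊤ ,_) (noCircuits i)) ,
          AtMostOneCircuit-anti (∈⊤ ,_) atMostOne ,
          λ j 1≤j j<k → minimal j 1≤j j<k ∘ AtMostOneCircuit-anti proj₂)

theorem3p10 : {n : ℕ} (G : Graph n) (r : ℕ) → 2 ≤ r
    → (Condition1 G r → VertexDecomposable (SigmaR G r))
    × (VertexDecomposable (SigmaR G r) → Condition1 G r)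
theorem3p10 G r 2≤r =
  VertexDecomposable-resp-≐ (≐-sym SigmaR≐Σᵣ) ∘ condition1⇒Σᵣ-vertexDecomposable ,
  λ vd → condition1In-⊤⇒condition1 (vertexDecomposable⇒condition1In 2≤r vd SigmaR≐Σᵣ)
  where open Circuits G r
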